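{- Let $s,t\ge 1$ be integers. Then $\chi_p(P_{3t}\Diamond_3 C_{4s})=3$ if $t=1$, and $\chi_p(P_{3t}\Diamond_3 C_{4s})=4$ if $t\ge 2$.
   Context: A packing $k$-coloring of a graph $H$ is a map $c:V(H)\to\{1,\ldots,k\}$ such that any two distinct vertices $u,v$ with $c(u)=c(v)=i$ satisfy $d_H(u,v)\ge i+1$. The packing chromatic number $\chi_p(H)$ is the least such $k$. $P_m$ denotes the path $v_1\cdots v_m$ and $C_n$ the cycle on $n$ vertices. Path-aligned product: for positive integers $\ell\mid m$ and a connected vertex-transitive graph $G$ containing $P_\ell$ as a subgraph, $P_m\Diamond_\ell G$ is formed from the path $P_m=v_1\cdots v_m$ and $m/\ell$ pairwise disjoint copies of $G$, where for each $1\le i\le m/\ell$ the consecutive path vertices $v_{(i-1)\ell+1},\ldots,v_{i\ell}$ are identified, in order, with the vertices of a path $P_\ell$ (i.e. $\ell$ consecutive cycle vertices when $G$ is a cycle) in the $i$-th copy of $G$. -}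

module Defs where

open import Data.Nat using (ℕ; zero; suc; _≤_)
open import Data.Fin using (Fin; toℕ)
open import Data.Product using (Σ; _×_; _,_)
open import Data.Sum using (_⊎_)
open import Relation.Binary.PropositionalEquality using (_≡_)
open import Relation.Nullary using (¬_)

record Graph : Set₁ where
  field
    V   : Set
    Adj : V → V → Set
open Graph public

data Walk (G : Graph) : V G → V G → ℕ → Set where
  here : ∀ {u} → Walk G u u 0
  step : ∀ {u w v n} → Adj G u w → Walk G w v n → Walk G u v (suc n)

DistGe : (G : Graph) → V G → V G → ℕ → Set
DistGe G u v k = ∀ n → Walk G u v n → k ≤ n

IsPackingColoring : (G : Graph) → ℕ → (V G → ℕ) → Set
IsPackingColoring G k c =
  (∀ v → 1 ≤ c v × c v ≤ k) ×
  (∀ u v → ¬ (u ≡ v) → c u ≡ c v → DistGe G u v (suc (c u)))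

PackingColorable : Graph → ℕ → Set
PackingColorable G k = Σ (V G → ℕ) (IsPackingColoring G k)

PackingChromaticNumberIs : Graph → ℕ → Set
PackingChromaticNumberIs G k =
  PackingColorable G k × (∀ j → PackingColorable G j → k ≤ j)

-- Cycle C_n on vertices 0,…,n-1 (i ~ i+1, and 0 ~ n-1); intended for n ≥ 3.
CycleAdj : (n : ℕ) → Fin n → Fin n → Set
CycleAdj n i j =
  (suc (toℕ i) ≡ toℕ j) ⊎ (suc (toℕ j) ≡ toℕ i) ⊎
  ((toℕ i ≡ 0 × suc (toℕ j) ≡ n) ⊎ (toℕ j ≡ 0 × suc (toℕ i) ≡ n))

-- Vertex (a , x) is vertex x of the a-th copy of C_n (a = 0,…,t-1).
-- Path vertex v_{aℓ+k+1} (0 ≤ k < ℓ) is identified with cycle vertex k of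
-- copy a, so the path edges inside a copy are cycle edges, and the
-- remaining path edges are v_{(a+1)ℓ} v_{(a+1)ℓ+1}, i.e. (a , ℓ-1) ~ (a+1 , 0).
PathCycleAdj : (ℓ t n : ℕ) → Fin t × Fin n → Fin t × Fin n → Set
PathCycleAdj ℓ t n (a , x) (b , y) =
  (a ≡ b × CycleAdj n x y) ⊎
  ((suc (toℕ a) ≡ toℕ b × suc (toℕ x) ≡ ℓ × toℕ y ≡ 0) ⊎
   (suc (toℕ b) ≡ toℕ a × suc (toℕ y) ≡ ℓ × toℕ x ≡ 0))

PathCycleProduct : (ℓ t n : ℕ) → Graph
PathCycleProduct ℓ t n = record
  { V = Fin t × Fin n ; Adj = PathCycleAdj ℓ t n }

-- Put d(a, x) = x + a on vertex x of copy a. Since 4 ∣ n and the bridge (a, 2)–(a+1, 0) lowers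
-- d by one, every edge changes d by ±1 modulo 4. Colour (a, x) by 1, 2, 1, 3 according to d mod 4:
-- colour 1 is one side of the bipartition given by the parity of d, and two vertices with the same
-- odd d mod 4 are joined only by walks of even length, those of length two running across a bridge
-- through a vertex at position 1. A single copy has no bridge, so three colours suffice. With
-- several copies the offending position-1 vertices, which lie in even copies, are recoloured 4; a
-- 1-Lipschitz potential growing by 3 per copy keeps any two of them at distance at least 6.
-- Conversely, two colours force both inner vertices of a path on four vertices to colour 2, and
-- three colours force both ends of a bridge to colour 2.

module Submission where

open import Defs
open import Data.Empty using (⊥-elim)
open import Data.Fin using (Fin; zero; suc; toℕ; fromℕ)
open import Data.Fin.Properties using (toℕ-injective; toℕ<n; toℕ-fromℕ)
open import Data.Nat using (ℕ; zero; suc; _+_; _*_; _≤_; _<_; _≥_; _≟_; _≤?_; z≤n; s≤s; ∣_-_∣; parity)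
open import Data.Nat.Divisibility using (_∣_; m∣m*n; >⇒∤)
open import Data.Nat.Properties
open import Data.Parity.Base as ℙ using (Parity; 0ℙ; 1ℙ; _⁻¹)
import Data.Parity.Properties as ℙₚ
open import Data.Product as Product using (_×_; _,_; proj₁; proj₂)
open import Data.Sum using (_⊎_; inj₁; inj₂; [_,_]′)
open import Function using (_∘_)
open import Relation.Binary.PropositionalEquality
open import Relation.Nullary using (¬_; Dec; yes; no; ¬?; contradiction)
open import Relation.Nullary.Decidable using (_×-dec_)

Periodic₄ : {A : Set} → (ℕ → A) → Set
Periodic₄ f = ∀ i → f (4 + i) ≡ f i

periodic-multiple : ∀ {A : Set} {f : ℕ → A} → Periodic₄ f → ∀ q i → f (q * 4 + i) ≡ f i
periodic-multiple per zero    i = refl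
periodic-multiple per (suc q) i = trans (per (q * 4 + i)) (periodic-multiple per q i)

parity-suc : ∀ m → parity (suc m) ≡ parity m ⁻¹
parity-suc m = sym (ℙₚ.⁻¹-selfInverse (ℙₚ.suc-homo-⁻¹ m))

parity-gap : ∀ {m n} → parity m ≡ parity n → m ≢ n → 2 ≤ ∣ m - n ∣
parity-gap {zero}        {zero}        _ m≢n = ⊥-elim (m≢n refl)
parity-gap {zero}        {suc zero}    ()
parity-gap {zero}        {suc (suc n)} _ _   = s≤s (s≤s z≤n)
parity-gap {suc zero}    {zero}        ()
parity-gap {suc (suc m)} {zero}        _ _   = s≤s (s≤s z≤n)
parity-gap {suc m}       {suc n}       same m≢n = parity-gap same′ (m≢n ∘ cong suc)
  where
  same′ : parity m ≡ parity n
  same′ = trans (sym (ℙₚ.suc-homo-⁻¹ m)) (trans (cong _⁻¹ same) (ℙₚ.suc-homo-⁻¹ n))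

∣m+o-n+o∣≡∣m-n∣ : ∀ m n o → ∣ m + o - n + o ∣ ≡ ∣ m - n ∣
∣m+o-n+o∣≡∣m-n∣ m n o = trans (cong₂ ∣_-_∣ (+-comm m o) (+-comm n o)) (∣m+n-m+o∣≡∣n-o∣ o m n)

two-or-three : ∀ {m} → 2 ≤ m → m ≤ 3 → m ≡ 2 ⊎ m ≡ 3
two-or-three (s≤s (s≤s z≤n)) (s≤s (s≤s z≤n))       = inj₁ refl
two-or-three (s≤s (s≤s z≤n)) (s≤s (s≤s (s≤s z≤n))) = inj₂ refl

pigeonhole : ∀ {a b d : ℕ} → a ≡ 2 ⊎ a ≡ 3 → b ≡ 2 ⊎ b ≡ 3 → d ≡ 2 ⊎ d ≡ 3 →
             a ≢ b → b ≢ d → a ≡ d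
pigeonhole (inj₁ refl) (inj₁ refl) _           a≢b _   = ⊥-elim (a≢b refl)
pigeonhole (inj₁ refl) (inj₂ refl) (inj₁ refl) _   _   = refl
pigeonhole (inj₁ refl) (inj₂ refl) (inj₂ refl) _   b≢d = ⊥-elim (b≢d refl)
pigeonhole (inj₂ refl) (inj₁ refl) (inj₁ refl) _   b≢d = ⊥-elim (b≢d refl)
pigeonhole (inj₂ refl) (inj₁ refl) (inj₂ refl) _   _   = refl
pigeonhole (inj₂ refl) (inj₂ refl) _           a≢b _   = ⊥-elim (a≢b refl)

motif : ℕ → ℕ
motif 0 = 1
motif 1 = 2
motif 2 = 1
motif 3 = 3
motif (suc (suc (suc (suc i)))) = motif i

motif-bounds : ∀ i → 1 ≤ motif i × motif i ≤ 3
motif-bounds 0 = s≤s z≤n , s≤s z≤n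
motif-bounds 1 = s≤s z≤n , s≤s (s≤s z≤n)
motif-bounds 2 = s≤s z≤n , s≤s z≤n
motif-bounds 3 = s≤s z≤n , ≤-refl
motif-bounds (suc (suc (suc (suc i)))) = motif-bounds i

motif≢4 : ∀ i → motif i ≢ 4
motif≢4 0 ()
motif≢4 1 ()
motif≢4 2 ()
motif≢4 3 ()
motif≢4 (suc (suc (suc (suc i)))) = motif≢4 i

motif-one⇒even : ∀ i → motif i ≡ 1 → parity i ≡ 0ℙ
motif-one⇒even 0 _ = refl
motif-one⇒even 1 ()
motif-one⇒even 2 _ = refl
motif-one⇒even 3 ()
motif-one⇒even (suc (suc (suc (suc i)))) = motif-one⇒even i

motif-other⇒odd : ∀ i → motif i ≢ 1 → parity i ≡ 1ℙ
motif-other⇒odd 0 other = ⊥-elim (other refl)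
motif-other⇒odd 1 _     = refl
motif-other⇒odd 2 other = ⊥-elim (other refl)
motif-other⇒odd 3 _     = refl
motif-other⇒odd (suc (suc (suc (suc i)))) = motif-other⇒odd i

motif-parity : ∀ i j → motif i ≡ motif j → parity i ≡ parity j
motif-parity i j same with motif i ≟ 1
... | yes one   = trans (motif-one⇒even i one) (sym (motif-one⇒even j (trans (sym same) one)))
... | no  other = trans (motif-other⇒odd i other) (sym (motif-other⇒odd j (other ∘ trans same)))

motif-half-turn : ∀ i → motif i ≢ 1 → motif (2 + i) ≢ motif i
motif-half-turn 0 other = ⊥-elim (other refl)
motif-half-turn 1 _     = λ ()
motif-half-turn 2 other = ⊥-elim (other refl)
motif-half-turn 3 _     = λ ()
motif-half-turn (suc (suc (suc (suc i)))) = motif-half-turn i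

stage : ℕ → ℕ
stage 0 = 0
stage 2 = 2
stage _ = 1

stage-step : ∀ x → ∣ stage x - stage (suc x) ∣ ≤ 1
stage-step 0 = ≤-refl
stage-step 1 = ≤-refl
stage-step 2 = ≤-refl
stage-step (suc (suc (suc x))) = z≤n

stage≤1 : ∀ {x} → x ≢ 2 → stage x ≤ 1
stage≤1 {0}                 _   = z≤n
stage≤1 {1}                 _   = ≤-refl
stage≤1 {2}                 x≢2 = ⊥-elim (x≢2 refl)
stage≤1 {suc (suc (suc _))} _   = ≤-refl

module _ {G : Graph} where

  walk-lipschitz : (f : V G → ℕ) → (∀ {u w} → Adj G u w → ∣ f u - f w ∣ ≤ 1) →
                   ∀ {u v L} → Walk G u v L → ∣ f u - f v ∣ ≤ L
  walk-lipschitz f lip {u} here = ≤-reflexive (∣n-n∣≡0 (f u))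
  walk-lipschitz f lip {u} {v} (step {w = w} uw W) =
    ≤-trans (∣-∣-triangle (f u) (f w) (f v)) (+-mono-≤ (lip uw) (walk-lipschitz f lip W))

  module _ (χ : V G → Parity) (flips : ∀ {u w} → Adj G u w → χ w ≡ χ u ⁻¹) where

    walk-parity : ∀ {u v L} → Walk G u v L → χ v ≡ parity L ℙ.+ χ u
    walk-parity here = refl
    walk-parity {u} {v} (step {w = w} {n = L} uw W) = begin
      χ v                     ≡⟨ walk-parity W ⟩
      parity L ℙ.+ χ w        ≡⟨ cong (parity L ℙ.+_) (flips uw) ⟩
      parity L ℙ.+ χ u ⁻¹     ≡⟨ shift (parity L) (χ u) ⟩
      parity L ⁻¹ ℙ.+ χ u     ≡⟨ cong (ℙ._+ χ u) (sym (parity-suc L)) ⟩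
      parity (suc L) ℙ.+ χ u  ∎
      where
      open ≡-Reasoning
      shift : ∀ p q → p ℙ.+ q ⁻¹ ≡ p ⁻¹ ℙ.+ q
      shift 0ℙ q = refl
      shift 1ℙ q = ℙₚ.⁻¹-involutive q

    even-walk : ∀ {u v L} → χ u ≡ χ v → Walk G u v L → parity L ≡ 0ℙ
    even-walk {u} same W = ℙₚ.+-cancelʳ-≡ (χ u) _ _ (sym (trans same (walk-parity W)))

-- Small configurations forcing many colours

module PackingObstructions {G : Graph} (adj-sym : ∀ {u w} → Adj G u w → Adj G w u)
                           (loopless : ∀ {u} → ¬ Adj G u u)
                           {k : ℕ} {c : V G → ℕ} (packing : IsPackingColoring G k c) where

  apart : ∀ {u v d} → u ≢ v → Walk G u v d → d ≤ c u → c u ≢ c v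
  apart u≢v W d≤cu same = <⇒≱ (proj₂ packing _ _ u≢v same _ W) d≤cu

  neighbours-apart : ∀ {u w} → Adj G u w → c u ≢ c w
  neighbours-apart uw = apart (λ { refl → loopless uw }) (step uw here) (proj₁ (proj₁ packing _))

  not-one⇒≥2 : ∀ {v} → c v ≢ 1 → 2 ≤ c v
  not-one⇒≥2 other = ≤∧≢⇒< (proj₁ (proj₁ packing _)) (other ∘ sym)

  not-one⇒two : k ≤ 2 → ∀ {v} → c v ≢ 1 → c v ≡ 2
  not-one⇒two k≤2 other = ≤-antisym (≤-trans (proj₂ (proj₁ packing _)) k≤2) (not-one⇒≥2 other)

  not-one⇒two-or-three : k ≤ 3 → ∀ {v} → c v ≢ 1 → c v ≡ 2 ⊎ c v ≡ 3
  not-one⇒two-or-three k≤3 other =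
    two-or-three (not-one⇒≥2 other) (≤-trans (proj₂ (proj₁ packing _)) k≤3)

  middle-is-two : k ≤ 2 → ∀ {x y z} → x ≢ z → Adj G x y → Adj G y z → c y ≡ 2
  middle-is-two k≤2 {x} {y} {z} x≢z xy yz with c y ≟ 1
  ... | no  cy≢1 = not-one⇒two k≤2 cy≢1
  ... | yes cy≡1 =
    ⊥-elim (apart x≢z (step xy (step yz here)) (≤-reflexive (sym cx≡2)) (trans cx≡2 (sym cz≡2)))
    where
    cx≡2 : c x ≡ 2
    cx≡2 = not-one⇒two k≤2 (λ cx≡1 → neighbours-apart xy (trans cx≡1 (sym cy≡1)))
    cz≡2 : c z ≡ 2
    cz≡2 = not-one⇒two k≤2 (λ cz≡1 → neighbours-apart yz (trans cy≡1 (sym cz≡1)))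

  hub-not-one : k ≤ 3 → ∀ {y x₁ x₂ x₃} → Adj G y x₁ → Adj G y x₂ → Adj G y x₃ →
                x₁ ≢ x₂ → x₂ ≢ x₃ → x₁ ≢ x₃ → c y ≢ 1
  hub-not-one k≤3 {y} yx₁ yx₂ yx₃ x₁≢x₂ x₂≢x₃ x₁≢x₃ cy≡1 =
    apart x₁≢x₃ (through yx₁ yx₃) (not-one⇒≥2 (leaf yx₁))
      (pigeonhole (leaf-colour yx₁) (leaf-colour yx₂) (leaf-colour yx₃)
        (apart x₁≢x₂ (through yx₁ yx₂) (not-one⇒≥2 (leaf yx₁)))
        (apart x₂≢x₃ (through yx₂ yx₃) (not-one⇒≥2 (leaf yx₂))))
    where
    through : ∀ {a b} → Adj G y a → Adj G y b → Walk G a b 2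
    through ya yb = step (adj-sym ya) (step yb here)
    leaf : ∀ {x} → Adj G y x → c x ≢ 1
    leaf yx cx≡1 = neighbours-apart yx (trans cy≡1 (sym cx≡1))
    leaf-colour : ∀ {x} → Adj G y x → c x ≡ 2 ⊎ c x ≡ 3
    leaf-colour yx = not-one⇒two-or-three k≤3 (leaf yx)

  -- p₁ is forced to colour 1, so p₀ shares the colour of q at distance 3.
  tail-is-two : k ≤ 3 → ∀ {p₀ p₁ p q} → Adj G p₀ p₁ → Adj G p₁ p → Adj G p q →
                p₀ ≢ p → p₁ ≢ q → p₀ ≢ q → c p ≢ 1 → c q ≢ 1 → c q ≡ 2
  tail-is-two k≤3 {p₀} {p₁} {p} {q} p₀p₁ p₁p pq p₀≢p p₁≢q p₀≢q cp≢1 cq≢1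
    with not-one⇒two-or-three k≤3 cq≢1
  ... | inj₁ cq≡2 = cq≡2
  ... | inj₂ cq≡3 =
    ⊥-elim (apart p₀≢q (step p₀p₁ (step p₁p (step pq here)))
                  (≤-reflexive (sym (trans cp₀≡cq cq≡3))) cp₀≡cq)
    where
    cp₁≡1 : c p₁ ≡ 1
    cp₁≡1 with c p₁ ≟ 1
    ... | yes cp₁≡1 = cp₁≡1
    ... | no  cp₁≢1 = ⊥-elim (apart p₁≢q (step p₁p (step pq here)) (not-one⇒≥2 cp₁≢1)
                        (pigeonhole (not-one⇒two-or-three k≤3 cp₁≢1) (not-one⇒two-or-three k≤3 cp≢1)
                          (not-one⇒two-or-three k≤3 cq≢1) (neighbours-apart p₁p) (neighbours-apart pq)))
    cp₀≢1 : c p₀ ≢ 1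
    cp₀≢1 cp₀≡1 = neighbours-apart p₀p₁ (trans cp₀≡1 (sym cp₁≡1))
    cp₀≡cq : c p₀ ≡ c q
    cp₀≡cq = pigeonhole (not-one⇒two-or-three k≤3 cp₀≢1) (not-one⇒two-or-three k≤3 cp≢1)
               (not-one⇒two-or-three k≤3 cq≢1)
               (apart p₀≢p (step p₀p₁ (step p₁p here)) (not-one⇒≥2 cp₀≢1)) (neighbours-apart pq)

-- The path-aligned product P_{3t} ◇₃ C_n

product-sym : ∀ {ℓ t n u w} → PathCycleAdj ℓ t n u w → PathCycleAdj ℓ t n w u
product-sym (inj₁ (a≡b , inj₁ e))                 = inj₁ (sym a≡b , inj₂ (inj₁ e))
product-sym (inj₁ (a≡b , inj₂ (inj₁ e)))          = inj₁ (sym a≡b , inj₁ e)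
product-sym (inj₁ (a≡b , inj₂ (inj₂ (inj₁ e))))   = inj₁ (sym a≡b , inj₂ (inj₂ (inj₂ e)))
product-sym (inj₁ (a≡b , inj₂ (inj₂ (inj₂ e))))   = inj₁ (sym a≡b , inj₂ (inj₂ (inj₁ e)))
product-sym (inj₂ (inj₁ e))                       = inj₂ (inj₂ e)
product-sym (inj₂ (inj₂ e))                       = inj₂ (inj₁ e)

product-loopless : ∀ {ℓ t n} → 1 < n → ∀ {u} → ¬ PathCycleAdj ℓ t n u u
product-loopless _   (inj₁ (_ , inj₁ e))                        = 1+n≢n e
product-loopless _   (inj₁ (_ , inj₂ (inj₁ e)))                 = 1+n≢n e
product-loopless 1<n (inj₁ (_ , inj₂ (inj₂ (inj₁ (x≡0 , sx≡n))))) =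
  <⇒≢ 1<n (trans (cong suc (sym x≡0)) sx≡n)
product-loopless 1<n (inj₁ (_ , inj₂ (inj₂ (inj₂ (x≡0 , sx≡n))))) =
  <⇒≢ 1<n (trans (cong suc (sym x≡0)) sx≡n)
product-loopless _   (inj₂ (inj₁ (e , _)))                      = 1+n≢n e
product-loopless _   (inj₂ (inj₂ (e , _)))                      = 1+n≢n e

module ChainColouring (n t : ℕ) (4∣n : 4 ∣ n) where

  open _∣_ 4∣n using (quotient; equality)

  G : Graph
  G = PathCycleProduct 3 t n

  Vertex : Set
  Vertex = Fin t × Fin n

  copy pos diag : Vertex → ℕ
  copy (a , _) = toℕ a
  pos  (_ , x) = toℕ x
  diag (a , x) = toℕ x + toℕ a

  private
    n≢1 : n ≢ 1
    n≢1 refl = >⇒∤ (s≤s (s≤s z≤n)) 4∣n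

    n≢3 : n ≢ 3
    n≢3 refl = >⇒∤ ≤-refl 4∣n

    vertex-≡ : ∀ {a b : Fin t} {x y : Fin n} → toℕ a ≡ toℕ b → toℕ x ≡ toℕ y → (a , x) ≡ (b , y)
    vertex-≡ a≡b x≡y = cong₂ _,_ (toℕ-injective a≡b) (toℕ-injective x≡y)

  data Rise : Vertex → Vertex → Set where
    along : ∀ {a x y} → suc (toℕ x) ≡ toℕ y → Rise (a , x) (a , y)
    wrap  : ∀ {a x y} → suc (toℕ x) ≡ n → toℕ y ≡ 0 → Rise (a , x) (a , y)
    back  : ∀ {a b x y} → suc (toℕ b) ≡ toℕ a → toℕ x ≡ 0 → suc (toℕ y) ≡ 3 → Rise (a , x) (b , y)

  adj⇒rise : ∀ {u w} → Adj G u w → Rise u w ⊎ Rise w u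
  adj⇒rise (inj₁ (refl , inj₁ s))                        = inj₁ (along s)
  adj⇒rise (inj₁ (refl , inj₂ (inj₁ s)))                 = inj₂ (along s)
  adj⇒rise (inj₁ (refl , inj₂ (inj₂ (inj₁ (x≡0 , sy))))) = inj₂ (wrap sy x≡0)
  adj⇒rise (inj₁ (refl , inj₂ (inj₂ (inj₂ (y≡0 , sx))))) = inj₁ (wrap sx y≡0)
  adj⇒rise (inj₂ (inj₁ (sa , sx , y≡0)))                 = inj₂ (back sa y≡0 sx)
  adj⇒rise (inj₂ (inj₂ (sb , sy , x≡0)))                 = inj₁ (back sb x≡0 sy)

  rise-shift : ∀ {A : Set} (f : ℕ → A) → Periodic₄ f →
               ∀ {u w} → Rise u w → f (diag w) ≡ f (suc (diag u))
  rise-shift f per (along {a} s) = cong (λ p → f (p + toℕ a)) (sym s)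
  rise-shift f per (wrap {a} {x} {y} s y≡0) = begin
    f (toℕ y + toℕ a)         ≡⟨ cong (λ p → f (p + toℕ a)) y≡0 ⟩
    f (toℕ a)                 ≡⟨ sym (periodic-multiple per quotient (toℕ a)) ⟩
    f (quotient * 4 + toℕ a)  ≡⟨ cong (λ m → f (m + toℕ a)) (sym (trans s equality)) ⟩
    f (suc (toℕ x) + toℕ a)   ∎
    where open ≡-Reasoning
  rise-shift f per (back {a} {b} {x} {y} sb x≡0 sy) = cong f (begin
    toℕ y + toℕ b        ≡⟨ cong (_+ toℕ b) (suc-injective sy) ⟩
    suc (suc (toℕ b))    ≡⟨ cong suc sb ⟩
    suc (toℕ a)          ≡⟨ cong (λ p → suc (p + toℕ a)) (sym x≡0) ⟩
    suc (toℕ x + toℕ a)  ∎)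
    where open ≡-Reasoning

  χ : Vertex → Parity
  χ v = parity (diag v)

  rise-flips : ∀ {u w} → Rise u w → χ w ≡ χ u ⁻¹
  rise-flips {u} r = trans (rise-shift parity (λ _ → refl) r) (parity-suc (diag u))

  adj-flips : ∀ {u w} → Adj G u w → χ w ≡ χ u ⁻¹
  adj-flips uw with adj⇒rise uw
  ... | inj₁ r = rise-flips r
  ... | inj₂ r = sym (ℙₚ.⁻¹-selfInverse (sym (rise-flips r)))

  AcrossBridge : Vertex → Vertex → Set
  AcrossBridge u v = copy u ≢ copy v × (pos u ≡ 1 ⊎ pos v ≡ 1)

  rises-to-same : ∀ {u v w} → Rise u w → Rise v w → u ≡ v ⊎ AcrossBridge u v
  rises-to-same (along s)      (along s′)      = inj₁ (vertex-≡ refl (suc-injective (trans s (sym s′))))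
  rises-to-same (along s)      (wrap _ y≡0)    = ⊥-elim (1+n≢0 (trans s y≡0))
  rises-to-same (along s)      (back sb _ sy)  =
    inj₂ ((λ e → 1+n≢n (trans sb (sym e))) , inj₁ (suc-injective (trans s (suc-injective sy))))
  rises-to-same (wrap _ y≡0)   (along s)       = ⊥-elim (1+n≢0 (trans s y≡0))
  rises-to-same (wrap s _)     (wrap s′ _)     = inj₁ (vertex-≡ refl (suc-injective (trans s (sym s′))))
  rises-to-same (wrap _ y≡0)   (back _ _ sy)   = contradiction (trans (cong suc (sym y≡0)) sy) λ ()
  rises-to-same (back sb _ sy) (along s)       =
    inj₂ ((λ e → 1+n≢n (trans sb e)) , inj₂ (suc-injective (trans s (suc-injective sy))))
  rises-to-same (back _ _ sy)  (wrap _ y≡0)    = contradiction (trans (cong suc (sym y≡0)) sy) λ ()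
  rises-to-same (back sb x≡0 _) (back sb′ x≡0′ _) =
    inj₁ (vertex-≡ (trans (sym sb) sb′) (trans x≡0 (sym x≡0′)))

  rises-from-same : ∀ {u v w} → Rise w u → Rise w v → u ≡ v ⊎ AcrossBridge u v
  rises-from-same (along s) (along s′) = inj₁ (vertex-≡ refl (trans (sym s) s′))
  rises-from-same {u = _ , x} (along s) (wrap s′ _) = contradiction (trans (sym s) s′) (<⇒≢ (toℕ<n x))
  rises-from-same (along s) (back sb z≡0 _) =
    inj₂ ((λ e → 1+n≢n (trans sb e)) , inj₁ (trans (sym s) (cong suc z≡0)))
  rises-from-same {v = _ , y} (wrap s′ _) (along s) = contradiction (trans (sym s) s′) (<⇒≢ (toℕ<n y))
  rises-from-same (wrap _ y≡0) (wrap _ y≡0′) = inj₁ (vertex-≡ refl (trans y≡0 (sym y≡0′)))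
  rises-from-same (wrap s _) (back _ z≡0 _) = ⊥-elim (n≢1 (trans (sym s) (cong suc z≡0)))
  rises-from-same (back sb z≡0 _) (along s) =
    inj₂ ((λ e → 1+n≢n (trans sb (sym e))) , inj₂ (trans (sym s) (cong suc z≡0)))
  rises-from-same (back _ z≡0 _) (wrap s _) = ⊥-elim (n≢1 (trans (sym s) (cong suc z≡0)))
  rises-from-same (back sb _ sy) (back sb′ _ sy′) =
    inj₁ (vertex-≡ (suc-injective (trans sb (sym sb′))) (suc-injective (trans sy (sym sy′))))

  colour₃ : Vertex → ℕ
  colour₃ v = motif (diag v)

  two-rises : ∀ {u w v} → Rise u w → Rise w v → colour₃ v ≡ motif (2 + diag u)
  two-rises r r′ = trans (rise-shift motif (λ _ → refl) r′) (rise-shift (motif ∘ suc) (λ _ → refl) r)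

  common-neighbour : ∀ {u w v} → Adj G u w → Adj G w v → colour₃ u ≡ colour₃ v → colour₃ u ≢ 1 →
                     u ≡ v ⊎ AcrossBridge u v
  common-neighbour {u} {w} {v} uw wv same other with adj⇒rise uw | adj⇒rise wv
  ... | inj₁ r | inj₁ r′ = ⊥-elim (motif-half-turn (diag u) other (sym (trans same (two-rises r r′))))
  ... | inj₁ r | inj₂ r′ = rises-to-same r r′
  ... | inj₂ r | inj₁ r′ = rises-from-same r r′
  ... | inj₂ r | inj₂ r′ =
    ⊥-elim (motif-half-turn (diag v) (other ∘ trans same) (trans (sym (two-rises r′ r)) same))

  same-colour-even : ∀ {u v L} → colour₃ u ≡ colour₃ v → Walk G u v L → parity L ≡ 0ℙ
  same-colour-even {u} {v} same = even-walk χ adj-flips (motif-parity (diag u) (diag v) same)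

  colour₃-apart : ∀ {u v} → u ≢ v → colour₃ u ≡ colour₃ v → (colour₃ u ≢ 1 → ¬ AcrossBridge u v) →
                  DistGe G u v (suc (colour₃ u))
  colour₃-apart u≢v _ _ 0 here = ⊥-elim (u≢v refl)
  colour₃-apart _ same _ 1 W = contradiction (same-colour-even same W) λ ()
  colour₃-apart {u} u≢v same no-bridge 2 (step uw (step wv here)) with colour₃ u ≟ 1
  ... | yes one   = ≤-reflexive (cong suc one)
  ... | no  other = ⊥-elim ([ u≢v , no-bridge other ]′ (common-neighbour uw wv same other))
  colour₃-apart _ same _ 3 W = contradiction (same-colour-even same W) λ ()
  colour₃-apart {u} _ _ _ (suc (suc (suc (suc L)))) _ =
    ≤-trans (s≤s (proj₂ (motif-bounds (diag u)))) (m≤m+n 4 L)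

  colour₃-packing : t ≤ 1 → IsPackingColoring G 3 colour₃
  colour₃-packing t≤1 = (λ v → motif-bounds (diag v)) ,
                        λ u v u≢v same → colour₃-apart u≢v same (λ _ → single-copy)
    where
    first : (a : Fin t) → toℕ a ≡ 0
    first a = n<1⇒n≡0 (≤-trans (toℕ<n a) t≤1)
    single-copy : ∀ {u v} → ¬ AcrossBridge u v
    single-copy {a , _} {b , _} (a≢b , _) = a≢b (trans (first a) (sym (first b)))

  -- Distance along the chain up to one: copy a is entered at position 0 and left at position 2.
  progress : Vertex → ℕ
  progress (a , x) = stage (toℕ x) + toℕ a * 3

  stage-lipschitz : ∀ {x y} → CycleAdj n x y → ∣ stage (toℕ x) - stage (toℕ y) ∣ ≤ 1
  stage-lipschitz {x} (inj₁ s) rewrite sym s = stage-step (toℕ x)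
  stage-lipschitz {x} {y} (inj₂ (inj₁ s)) rewrite sym s =
    subst (_≤ 1) (∣-∣-comm (stage (toℕ y)) _) (stage-step (toℕ y))
  stage-lipschitz {x} {y} (inj₂ (inj₂ (inj₁ (x≡0 , sy≡n)))) rewrite x≡0 =
    stage≤1 (λ y≡2 → n≢3 (trans (sym sy≡n) (cong suc y≡2)))
  stage-lipschitz {x} {y} (inj₂ (inj₂ (inj₂ (y≡0 , sx≡n)))) rewrite y≡0 =
    subst (_≤ 1) (sym (∣-∣-identityʳ _)) (stage≤1 (λ x≡2 → n≢3 (trans (sym sx≡n) (cong suc x≡2))))

  across-bridge : ∀ {a b x y} → suc (toℕ a) ≡ toℕ b × suc (toℕ x) ≡ 3 × toℕ y ≡ 0 →
                  ∣ progress (a , x) - progress (b , y) ∣ ≤ 1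
  across-bridge {a} (sa , sx , y≡0) rewrite sym sa | suc-injective sx | y≡0 =
    ≤-reflexive (∣m+o-n+o∣≡∣m-n∣ 2 3 (toℕ a * 3))

  progress-lipschitz : ∀ {u w} → Adj G u w → ∣ progress u - progress w ∣ ≤ 1
  progress-lipschitz {a , x} {_ , y} (inj₁ (refl , cyc)) =
    ≤-trans (≤-reflexive (∣m+o-n+o∣≡∣m-n∣ (stage (toℕ x)) (stage (toℕ y)) (toℕ a * 3)))
            (stage-lipschitz cyc)
  progress-lipschitz (inj₂ (inj₁ e)) = across-bridge e
  progress-lipschitz {u} {w} (inj₂ (inj₂ e)) =
    subst (_≤ 1) (∣-∣-comm (progress w) (progress u)) (across-bridge e)

  Marked : Vertex → Set
  Marked v = pos v ≡ 1 × colour₃ v ≢ 1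

  marked? : (v : Vertex) → Dec (Marked v)
  marked? v = (pos v ≟ 1) ×-dec ¬? (colour₃ v ≟ 1)

  colour₄ : Vertex → ℕ
  colour₄ v with marked? v
  ... | yes _ = 4
  ... | no  _ = colour₃ v

  marked-copy-even : ∀ {v} → Marked v → parity (copy v) ≡ 0ℙ
  marked-copy-even {a , x} (x≡1 , other) = sym (ℙₚ.⁻¹-selfInverse (begin
    parity (toℕ a) ⁻¹      ≡⟨ sym (parity-suc (toℕ a)) ⟩
    parity (suc (toℕ a))   ≡⟨ cong (λ p → parity (p + toℕ a)) (sym x≡1) ⟩
    parity (diag (a , x))  ≡⟨ motif-other⇒odd (diag (a , x)) other ⟩
    1ℙ                     ∎))
    where open ≡-Reasoning

  marked-apart : ∀ {u v} → Marked u → Marked v → u ≢ v → DistGe G u v 5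
  marked-apart {a , x} {b , y} mu@(x≡1 , _) mv@(y≡1 , _) u≢v L W = begin
    5                                        ≤⟨ n≤1+n 5 ⟩
    2 * 3                                    ≤⟨ *-monoˡ-≤ 3 gap ⟩
    ∣ toℕ a - toℕ b ∣ * 3                    ≡⟨ *-distribʳ-∣-∣ 3 (toℕ a) (toℕ b) ⟩
    ∣ toℕ a * 3 - toℕ b * 3 ∣                ≡⟨ sym (∣m+n-m+o∣≡∣n-o∣ 1 (toℕ a * 3) (toℕ b * 3)) ⟩
    ∣ 1 + toℕ a * 3 - 1 + toℕ b * 3 ∣        ≡⟨ cong₂ (λ p q → ∣ stage p + toℕ a * 3 - stage q + toℕ b * 3 ∣)
                                                      (sym x≡1) (sym y≡1) ⟩
    ∣ progress (a , x) - progress (b , y) ∣  ≤⟨ walk-lipschitz progress progress-lipschitz W ⟩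
    L                                        ∎
    where
    open ≤-Reasoning
    gap : 2 ≤ ∣ toℕ a - toℕ b ∣
    gap = parity-gap (trans (marked-copy-even mu) (sym (marked-copy-even mv)))
                     (λ a≡b → u≢v (vertex-≡ a≡b (trans x≡1 (sym y≡1))))

  colour₄-packing : IsPackingColoring G 4 colour₄
  colour₄-packing = bounds , apart
    where
    bounds : ∀ v → 1 ≤ colour₄ v × colour₄ v ≤ 4
    bounds v with marked? v
    ... | yes _ = s≤s z≤n , ≤-refl
    ... | no  _ = Product.map₂ m≤n⇒m≤1+n (motif-bounds (diag v))
    apart : ∀ u v → u ≢ v → colour₄ u ≡ colour₄ v → DistGe G u v (suc (colour₄ u))
    apart u v u≢v same with marked? u | marked? v
    ... | yes mu | yes mv = marked-apart mu mv u≢v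
    ... | yes _  | no  _  = ⊥-elim (motif≢4 (diag v) (sym same))
    ... | no  _  | yes _  = ⊥-elim (motif≢4 (diag u) same)
    ... | no  mu | no  mv = colour₃-apart u≢v same no-bridge
      where
      no-bridge : colour₃ u ≢ 1 → ¬ AcrossBridge u v
      no-bridge other (_ , inj₁ pu) = mu (pu , other)
      no-bridge other (_ , inj₂ pv) = mv (pv , other ∘ trans same)

-- Lower bounds

three-colours-needed : ∀ {t n k} → 1 ≤ t → 4 ≤ n → PackingColorable (PathCycleProduct 3 t n) k → 3 ≤ k
three-colours-needed {suc t} {suc (suc (suc (suc m)))} {k} (s≤s _) (s≤s (s≤s (s≤s (s≤s _)))) (c , packing)
  with 3 ≤? k
... | yes 3≤k = 3≤k
... | no  3≰k = ⊥-elim (neighbours-apart v₁v₂ (trans (middle-is-two k≤2 (λ ()) v₀v₁ v₁v₂)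
                                                      (sym (middle-is-two k≤2 (λ ()) v₁v₂ v₂v₃))))
  where
  open PackingObstructions product-sym (product-loopless (s≤s (s≤s z≤n))) packing
  k≤2 : k ≤ 2
  k≤2 = ≤-pred (≰⇒> 3≰k)
  _~_ : Fin (suc t) × Fin (4 + m) → Fin (suc t) × Fin (4 + m) → Set
  _~_ = PathCycleAdj 3 (suc t) (4 + m)
  v₀v₁ : (zero , zero) ~ (zero , suc zero)
  v₀v₁ = inj₁ (refl , inj₁ refl)
  v₁v₂ : (zero , suc zero) ~ (zero , suc (suc zero))
  v₁v₂ = inj₁ (refl , inj₁ refl)
  v₂v₃ : (zero , suc (suc zero)) ~ (zero , suc (suc (suc zero)))
  v₂v₃ = inj₁ (refl , inj₁ refl)

four-colours-needed : ∀ {t n k} → 2 ≤ t → 4 ≤ n → PackingColorable (PathCycleProduct 3 t n) k → 4 ≤ k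
four-colours-needed {suc (suc t)} {suc (suc (suc (suc m)))} {k} (s≤s (s≤s _)) (s≤s (s≤s (s≤s (s≤s _))))
                    (c , packing) with 4 ≤? k
... | yes 4≤k = 4≤k
... | no  4≰k = ⊥-elim (neighbours-apart v₂w₁ (trans v₂≡2 (sym w₁≡2)))
  where
  open PackingObstructions product-sym (product-loopless (s≤s (s≤s z≤n))) packing
  k≤3 : k ≤ 3
  k≤3 = ≤-pred (≰⇒> 4≰k)
  Vertex : Set
  Vertex = Fin (2 + t) × Fin (4 + m)
  _~_ : Vertex → Vertex → Set
  _~_ = PathCycleAdj 3 (2 + t) (4 + m)
  v₀ v₁ v₂ v₃ w₀ w₁ w₂ w₃ : Vertex
  v₀ = zero , zero
  v₁ = zero , suc zero
  v₂ = zero , suc (suc zero)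
  v₃ = zero , suc (suc (suc zero))
  w₀ = suc zero , fromℕ (3 + m)
  w₁ = suc zero , zero
  w₂ = suc zero , suc zero
  w₃ = suc zero , suc (suc zero)
  v₀v₁ : v₀ ~ v₁
  v₀v₁ = inj₁ (refl , inj₁ refl)
  v₁v₂ : v₁ ~ v₂
  v₁v₂ = inj₁ (refl , inj₁ refl)
  v₂v₃ : v₂ ~ v₃
  v₂v₃ = inj₁ (refl , inj₁ refl)
  v₂w₁ : v₂ ~ w₁
  v₂w₁ = inj₂ (inj₁ (refl , refl , refl))
  w₁w₀ : w₁ ~ w₀
  w₁w₀ = inj₁ (refl , inj₂ (inj₂ (inj₁ (refl , cong suc (toℕ-fromℕ (3 + m))))))
  w₁w₂ : w₁ ~ w₂
  w₁w₂ = inj₁ (refl , inj₁ refl)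
  w₂w₃ : w₂ ~ w₃
  w₂w₃ = inj₁ (refl , inj₁ refl)
  v₂≢1 : c v₂ ≢ 1
  v₂≢1 = hub-not-one k≤3 (product-sym v₁v₂) v₂v₃ v₂w₁ (λ ()) (λ ()) (λ ())
  w₁≢1 : c w₁ ≢ 1
  w₁≢1 = hub-not-one k≤3 w₁w₀ w₁w₂ (product-sym v₂w₁) (λ ()) (λ ()) (λ ())
  w₁≡2 : c w₁ ≡ 2
  w₁≡2 = tail-is-two k≤3 v₀v₁ v₁v₂ v₂w₁ (λ ()) (λ ()) (λ ()) v₂≢1 w₁≢1
  v₂≡2 : c v₂ ≡ 2
  v₂≡2 = tail-is-two k≤3 (product-sym w₂w₃) (product-sym w₁w₂) (product-sym v₂w₁)
                     (λ ()) (λ ()) (λ ()) w₁≢1 v₂≢1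

theorem2 : (s t : ℕ) → s ≥ 1 → t ≥ 1 →
    (t ≡ 1 → PackingChromaticNumberIs (PathCycleProduct 3 t (4 * s)) 3) ×
    (t ≥ 2 → PackingChromaticNumberIs (PathCycleProduct 3 t (4 * s)) 4)
theorem2 s t s≥1 t≥1 = one-copy , several-copies
  where
  open ChainColouring (4 * s) t (m∣m*n s)
  4≤n : 4 ≤ 4 * s
  4≤n = *-monoʳ-≤ 4 s≥1
  one-copy : t ≡ 1 → PackingChromaticNumberIs G 3
  one-copy t≡1 = (colour₃ , colour₃-packing (≤-reflexive t≡1)) , λ _ → three-colours-needed t≥1 4≤n
  several-copies : t ≥ 2 → PackingChromaticNumberIs G 4
  several-copies t≥2 = (colour₄ , colour₄-packing) , λ _ → four-colours-needed t≥2 4≤n
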